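{- Let $D$ be a bipartite tournament, and suppose that $(u,v)$ is an arc of $D$ and $d^+_D(v)\ge 1$. Then $u$ and $v$ are adjacent in $C_{1,2}(D)$ if and only if $u$ has at least two out-neighbors in $D$.
   Context: A bipartite tournament is an orientation of a complete bipartite graph $K_{m,n}$ ($m,n\ge1$). $d^+_D(v)$ denotes the outdegree of $v$ in $D$. For vertices $x,y$ of a digraph $H$, $d_H(x,y)$ is the length of a shortest directed $(x,y)$-path. The $(1,2)$-step competition graph $C_{1,2}(D)$ is the simple graph on $V(D)$ in which distinct $u,v$ are adjacent iff there is $w\neq u,v$ with either $d_{D-v}(u,w)\le 1$ and $d_{D-u}(v,w)\le 2$, or $d_{D-u}(v,w)\le 1$ and $d_{D-v}(u,w)\le 2$. -}

module Defs where

open import Data.Nat using (ℕ; zero; suc)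
open import Data.Fin using (Fin)
open import Data.Bool using (Bool; true; false)
open import Data.Bool.Properties using () renaming (_≟_ to _≟ᵇ_)
open import Data.Sum using (_⊎_; inj₁; inj₂)
open import Data.Product using (_×_; ∃-syntax)
open import Data.Empty using (⊥)
open import Data.List using (List; length; filter)
import Data.List
open import Relation.Binary.PropositionalEquality using (_≡_; _≢_)

-- A bipartite tournament: an orientation of K_{m,n} with parts Fin m and Fin n.
-- T a b ≡ true means the arc goes a → b; T a b ≡ false means b → a.
BipTournament : ℕ → ℕ → Set
BipTournament m n = Fin m → Fin n → Bool

Vertex : ℕ → ℕ → Set
Vertex m n = Fin m ⊎ Fin n

Arc : ∀ {m n} → BipTournament m n → Vertex m n → Vertex m n → Set
Arc T (inj₁ a) (inj₁ a′) = ⊥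
Arc T (inj₁ a) (inj₂ b) = T a b ≡ true
Arc T (inj₂ b) (inj₁ a) = T a b ≡ false
Arc T (inj₂ b) (inj₂ b′) = ⊥

allFin : (k : ℕ) → List (Fin k)
allFin k = Data.List.allFin k

outdeg : ∀ {m n} → BipTournament m n → Vertex m n → ℕ
outdeg {m} {n} T (inj₁ a) = length (filter (λ b → T a b ≟ᵇ true) (allFin n))
outdeg {m} {n} T (inj₂ b) = length (filter (λ a → T a b ≟ᵇ false) (allFin m))

-- WalkLe T z k x y : in D - z, there is a directed (x,y)-walk of length ≤ k,
-- i.e. d_{D-z}(x,y) ≤ k (all vertices of the walk, including x and y, differ from z).
data WalkLe {m n} (T : BipTournament m n) (z : Vertex m n) :
            ℕ → Vertex m n → Vertex m n → Set where
  here : ∀ {k x} → x ≢ z → WalkLe T z k x x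
  step : ∀ {k x y w} → x ≢ z → Arc T x y → WalkLe T z k y w → WalkLe T z (suc k) x w

Adj12 : ∀ {m n} → BipTournament m n → Vertex m n → Vertex m n → Set
Adj12 T u v =
  u ≢ v × (∃[ w ] (w ≢ u × w ≢ v ×
    ((WalkLe T v 1 u w × WalkLe T u 2 v w) ⊎ (WalkLe T u 1 v w × WalkLe T v 2 u w))))

-- Let u → v → a. Then a lies in the part of u while every out-neighbour x ≠ v
-- of u lies in the other part, so x and a are joined by an arc. If a → x, then x
-- is reached by u in one step avoiding v and by v in two steps (v → a → x)
-- avoiding u; if x → a, the roles swap with prey a (v → a and u → x → a).
-- Conversely, a walk witnessing adjacency starts at u inside D - v, so its first
-- arc leads to an out-neighbour of u other than v.
module Submission where

open import Defs
open import Data.Nat using (ℕ; suc; _≤_; z≤n; s≤s)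
open import Data.Fin using () renaming (_≟_ to _≟ᶠ_)
open import Data.Bool using (true; false)
open import Data.Bool.Properties using () renaming (_≟_ to _≟ᵇ_)
open import Data.Sum using (_⊎_; inj₁; inj₂)
open import Data.Sum.Properties using (inj₁-injective; inj₂-injective; ≡-dec)
open import Data.Product using (_×_; _,_; proj₂; ∃; ∃₂; map; map₂)
open import Data.Empty using (⊥-elim)
open import Data.List using (List; []; _∷_; length; filter)
open import Data.List.Membership.Propositional using (_∈_)
open import Data.List.Membership.Propositional.Properties using (∈-filter⁺; ∈-filter⁻; ∈-allFin)
open import Data.List.Relation.Unary.Any using (here; there)
open import Data.List.Relation.Unary.All using (_∷_)
open import Data.List.Relation.Unary.AllPairs using (_∷_)
open import Data.List.Relation.Unary.Unique.Propositional using (Unique)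
open import Data.List.Relation.Unary.Unique.Propositional.Properties using (filter⁺; allFin⁺)
open import Function.Base using (id)
open import Function.Bundles using (_⇔_; mk⇔)
open import Function.Properties.Equivalence using () renaming (trans to ⇔-trans; sym to ⇔-sym)
open import Relation.Binary.PropositionalEquality using (_≢_; refl; sym; trans; cong)
open import Relation.Nullary using (¬_; yes; no)
open import Relation.Unary using (Decidable)

module _ {A : Set} where

  1≤length⇒∈ : {xs : List A} → 1 ≤ length xs → ∃ (_∈ xs)
  1≤length⇒∈ {x ∷ _} _ = x , here refl

  2≤length⇒distinct∈ : {xs : List A} → Unique xs → 2 ≤ length xs →
                       ∃₂ λ x y → x ∈ xs × y ∈ xs × x ≢ y
  2≤length⇒distinct∈ {x ∷ y ∷ _} ((x≢y ∷ _) ∷ _) _ = x , y , here refl , there (here refl) , x≢y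
  2≤length⇒distinct∈ {_ ∷ []} _ (s≤s ())

  distinct∈⇒2≤length : {xs : List A} {x y : A} → x ∈ xs → y ∈ xs → x ≢ y → 2 ≤ length xs
  distinct∈⇒2≤length {_ ∷ _ ∷ _} _ _ _ = s≤s (s≤s z≤n)
  distinct∈⇒2≤length {_ ∷ []} (here refl) (here refl) x≢y = ⊥-elim (x≢y refl)

module _ {A : Set} {P : A → Set} (P? : Decidable P) (xs : List A) where

  1≤length-filter⇒∃ : 1 ≤ length (filter P? xs) → ∃ P
  1≤length-filter⇒∃ d = map₂ (λ x∈ → proj₂ (∈-filter⁻ P? {xs = xs} x∈)) (1≤length⇒∈ d)

  2≤length-filter⇒distinct : Unique xs → 2 ≤ length (filter P? xs) → ∃₂ λ x y → P x × P y × x ≢ y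
  2≤length-filter⇒distinct xs! d with x , y , x∈ , y∈ , x≢y ← 2≤length⇒distinct∈ (filter⁺ P? xs!) d =
    x , y , proj₂ (∈-filter⁻ P? {xs = xs} x∈) , proj₂ (∈-filter⁻ P? {xs = xs} y∈) , x≢y

  distinct⇒2≤length-filter : ∀ {x y} → x ∈ xs → y ∈ xs → P x → P y → x ≢ y → 2 ≤ length (filter P? xs)
  distinct⇒2≤length-filter x∈ y∈ px py = distinct∈⇒2≤length (∈-filter⁺ P? x∈ px) (∈-filter⁺ P? y∈ py)

module _ {m n : ℕ} (T : BipTournament m n) where

  OutNeighbourBesides : Vertex m n → Vertex m n → Set
  OutNeighbourBesides u v = ∃ λ x → Arc T u x × x ≢ v

  Arc-irrefl : ∀ x → ¬ Arc T x x
  Arc-irrefl (inj₁ _) ()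
  Arc-irrefl (inj₂ _) ()

  Arc⇒≢ : ∀ {x y} → Arc T x y → x ≢ y
  Arc⇒≢ {x} xy refl = Arc-irrefl x xy

  Arc-asym : ∀ x y → Arc T x y → ¬ Arc T y x
  Arc-asym (inj₁ a) (inj₂ b) p q with () ← trans (sym p) q
  Arc-asym (inj₂ b) (inj₁ a) p q with () ← trans (sym q) p

  two-step-comparable : ∀ {u v a x} → Arc T u v → Arc T v a → Arc T u x →
                        Arc T a x ⊎ Arc T x a
  two-step-comparable {inj₁ _} {inj₂ _} {inj₁ r} {inj₂ s} _ _ _ with T r s
  ... | true  = inj₁ refl
  ... | false = inj₂ refl
  two-step-comparable {inj₂ _} {inj₁ _} {inj₂ r} {inj₁ s} _ _ _ with T s r
  ... | true  = inj₂ refl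
  ... | false = inj₁ refl

  outdeg≥1⇒outNeighbour : ∀ v → 1 ≤ outdeg T v → ∃ (Arc T v)
  outdeg≥1⇒outNeighbour (inj₁ a) d = map inj₂ id (1≤length-filter⇒∃ (λ b → T a b ≟ᵇ true) (allFin n) d)
  outdeg≥1⇒outNeighbour (inj₂ b) d = map inj₁ id (1≤length-filter⇒∃ (λ a → T a b ≟ᵇ false) (allFin m) d)

  outdeg≥2⇒distinctOutNeighbours : ∀ u → 2 ≤ outdeg T u →
                                   ∃₂ λ x y → Arc T u x × Arc T u y × x ≢ y
  outdeg≥2⇒distinctOutNeighbours (inj₁ a) d
    with b , c , ab , ac , b≢c ← 2≤length-filter⇒distinct (λ b → T a b ≟ᵇ true) (allFin n) (allFin⁺ n) d =
    inj₂ b , inj₂ c , ab , ac , λ e → b≢c (inj₂-injective e)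
  outdeg≥2⇒distinctOutNeighbours (inj₂ b) d
    with a , c , ba , bc , a≢c ← 2≤length-filter⇒distinct (λ a → T a b ≟ᵇ false) (allFin m) (allFin⁺ m) d =
    inj₁ a , inj₁ c , ba , bc , λ e → a≢c (inj₁-injective e)

  distinctOutNeighbours⇒outdeg≥2 : ∀ {u x y} → Arc T u x → Arc T u y → x ≢ y → 2 ≤ outdeg T u
  distinctOutNeighbours⇒outdeg≥2 {inj₁ a} {inj₂ b} {inj₂ c} ux uy x≢y =
    distinct⇒2≤length-filter (λ b → T a b ≟ᵇ true) (allFin n) (∈-allFin b) (∈-allFin c) ux uy
      (λ b≡c → x≢y (cong inj₂ b≡c))
  distinctOutNeighbours⇒outdeg≥2 {inj₂ b} {inj₁ a} {inj₁ c} ux uy x≢y =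
    distinct⇒2≤length-filter (λ a → T a b ≟ᵇ false) (allFin m) (∈-allFin a) (∈-allFin c) ux uy
      (λ a≡c → x≢y (cong inj₁ a≡c))

  outdeg≥2⇔outNeighbourBesides : ∀ {u v} → Arc T u v → (2 ≤ outdeg T u) ⇔ OutNeighbourBesides u v
  outdeg≥2⇔outNeighbourBesides {u} {v} uv = mk⇔ avoid (λ (x , ux , x≢v) → distinctOutNeighbours⇒outdeg≥2 ux uv x≢v)
    where
    avoid : 2 ≤ outdeg T u → OutNeighbourBesides u v
    avoid d with x , y , ux , uy , x≢y ← outdeg≥2⇒distinctOutNeighbours u d
                 | ≡-dec _≟ᶠ_ _≟ᶠ_ x v
    ... | no  x≢v = x , ux , x≢v
    ... | yes refl = y , uy , λ y≡x → x≢y (sym y≡x)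

  walk-start≢ : ∀ {z k x w} → WalkLe T z k x w → x ≢ z
  walk-start≢ (here x≢z)     = x≢z
  walk-start≢ (step x≢z _ _) = x≢z

  walk-first-arc : ∀ {z k x w} → WalkLe T z k x w → w ≢ x → OutNeighbourBesides x z
  walk-first-arc (here _)         w≢x = ⊥-elim (w≢x refl)
  walk-first-arc (step _ xy rest) _   = _ , xy , walk-start≢ rest

  arc-walk : ∀ {z k x y} → x ≢ z → Arc T x y → y ≢ z → WalkLe T z (suc k) x y
  arc-walk x≢z xy y≢z = step x≢z xy (here y≢z)

  adj₁₂⇔outNeighbourBesides : ∀ {u v} → Arc T u v → ∃ (Arc T v) →
                              Adj12 T u v ⇔ OutNeighbourBesides u v
  adj₁₂⇔outNeighbourBesides {u} {v} uv (a , va) = mk⇔ prey prey⇒adj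
    where
    prey : Adj12 T u v → OutNeighbourBesides u v
    prey (_ , w , w≢u , _ , inj₁ (u⇝w , _)) = walk-first-arc u⇝w w≢u
    prey (_ , w , w≢u , _ , inj₂ (_ , u⇝w)) = walk-first-arc u⇝w w≢u

    u≢v : u ≢ v
    u≢v = Arc⇒≢ uv
    a≢u : a ≢ u
    a≢u refl = Arc-asym u v uv va
    a≢v : a ≢ v
    a≢v a≡v = Arc⇒≢ va (sym a≡v)

    prey⇒adj : OutNeighbourBesides u v → Adj12 T u v
    prey⇒adj (x , ux , x≢v) with two-step-comparable uv va ux
    ... | inj₁ ax = u≢v , x , x≢u , x≢v ,
                    inj₁ (arc-walk u≢v ux x≢v , step (λ e → u≢v (sym e)) va (arc-walk a≢u ax x≢u))
      where x≢u = λ x≡u → Arc⇒≢ ux (sym x≡u)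
    ... | inj₂ xa = u≢v , a , a≢u , a≢v ,
                    inj₂ (arc-walk (λ e → u≢v (sym e)) va a≢u , step u≢v ux (arc-walk x≢v xa a≢v))

corollary2p5 : (m n : ℕ) → 1 ≤ m → 1 ≤ n → (T : BipTournament m n)
    → (u v : Vertex m n) → Arc T u v → 1 ≤ outdeg T v
    → Adj12 T u v ⇔ (2 ≤ outdeg T u)
corollary2p5 _ _ _ _ T u v uv d⁺v≥1 =
  ⇔-trans (adj₁₂⇔outNeighbourBesides T uv (outdeg≥1⇒outNeighbour T v d⁺v≥1))
          (⇔-sym (outdeg≥2⇔outNeighbourBesides T uv))
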